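{- Let $n\ge 1$, $q\geq 2$, $d$ and $s$ be integers with $0\leq d\leq n(q-1)$ and $0\le s\leq \frac{n}{2}$. Let $\mathcal{V}\subseteq \{0,1,\ldots,q-1\}^n$ be a $d$-uniform tuple system such that $\mathcal{V}$ shatters no subset of $[n]$ of size $s+1$. Then $$|\mathcal{V}|\leq \sum_{i=0}^s (q-1)^{n-i}\left( {n \choose i}-{n \choose i-1}\right).$$
   Context: $[n]=\{1,\ldots,n\}$ and $(q)=\{0,1,\ldots,q-1\}$. A tuple system is a subset $\mathcal{V}\subseteq (q)^n$; a tuple $\mathbf v=(v_1,\ldots,v_n)$ is viewed as a function $[n]\to(q)$. $\mathcal{V}$ shatters $S\subseteq[n]$ if $\{\mathbf v|_S:\mathbf v\in\mathcal V\}$ is the set of all functions $S\to (q)$. $\mathcal V$ is $d$-uniform if $\sum_{i=1}^n v_i=d$ for every $(v_1,\ldots,v_n)\in\mathcal V$. Convention: ${n\choose -1}=0$. -}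

module Defs where

open import Data.Nat using (ℕ; zero; suc; _+_; _*_; _∸_; _^_)
open import Data.Nat.Combinatorics using (_C_)
open import Data.Integer as ℤ using (ℤ; +_)
open import Data.Fin using (Fin; toℕ)
open import Data.Fin.Subset using (Subset; _∈_)
open import Data.Vec using (Vec; lookup; map; sum)
open import Data.List using (List)
open import Data.List.Membership.Propositional renaming (_∈_ to _∈ˡ_)
open import Data.Product using (∃; _×_)
open import Relation.Binary.PropositionalEquality using (_≡_)

Tuple : ℕ → ℕ → Set
Tuple n q = Vec (Fin q) n

Uniform : ∀ {n q} → ℕ → List (Tuple n q) → Set
Uniform d V = ∀ v → v ∈ˡ V → sum (map toℕ v) ≡ d

-- V shatters S: every function S → (q) is the restriction of some v ∈ V.
-- (Functions S → (q) are represented by their extensions to [n], i.e. tuples.)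
Shatters : ∀ {n q} → List (Tuple n q) → Subset n → Set
Shatters {n} {q} V S =
  ∀ (f : Tuple n q) → ∃ λ v → v ∈ˡ V × (∀ (i : Fin n) → i ∈ S → lookup v i ≡ lookup f i)

-- binom n (i-1) with the convention C(n,-1) = 0
prevBinom : ℕ → ℕ → ℕ
prevBinom n zero = 0
prevBinom n (suc i) = n C i

term : ℕ → ℕ → ℕ → ℤ
term n q i = (+ ((q ∸ 1) ^ (n ∸ i))) ℤ.* ((+ (n C i)) ℤ.- (+ prevBinom n i))

bound : ℕ → ℕ → ℕ → ℤ
bound n q zero = term n q zero
bound n q (suc s) = bound n q s ℤ.+ term n q (suc s)

-- Identify V with its membership predicate on (q)^n and count. Splitting along the first
-- coordinate, a family P has at most (q - 1)·|proj P| + |full P| members, where proj P is the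
-- projection of P to the remaining coordinates and full P the set of tails all of whose q
-- extensions lie in P; a set shattered by proj P (by full P) is shattered by P once the first
-- coordinate is added outside (inside) it. This recursion yields the q-ary Sauer–Shelah bound.
--
-- For q ≥ 3, d-uniformity determines the first coordinate by the others, so |V| = |proj V|, and
-- the Sauer–Shelah bound for proj V in dimension n - 1 is at most the stated sum.
-- For q = 2 the stated sum telescopes to C(n, s). Here the recursion is run for families whose
-- weights lie in a window of k consecutive values, with bound Σ_{j<k} C(n, s - j): projection
-- widens the window by one, full fibres narrow it by one, and 2s < n + k is preserved. A
-- d-uniform family is the case k = 1.
module Submission where

open import Algebra.Properties.CommutativeSemigroup using (interchange; xy∙z≈xz∙y)
open import Data.Bool.Base using (Bool; true; false; T; _∨_)
open import Data.Fin.Base using (Fin; zero; suc; toℕ; punchIn)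
open import Data.Fin.Properties using (any?; all?; ¬∀⟶∃¬; punchInᵢ≢i; toℕ≤pred[n]; toℕ-injective)
  renaming (_≟_ to _≟ᶠ_)
open import Data.Fin.Subset using (Subset; _∈_; ∣_∣; inside; outside; ⊥)
open import Data.Fin.Subset.Properties using (∉⊥; ∣⊥∣≡0)
open import Data.Integer.Base as ℤ using (+_; +≤+; _⊖_) renaming (_≤_ to _≤ℤ_)
import Data.Integer.Properties as ℤ
open import Data.List.Base using (List; []; _∷_; length)
open import Data.List.Membership.Propositional using () renaming (_∈_ to _∈ˡ_)
open import Data.List.Relation.Unary.All.Properties using (All¬⇒¬Any)
open import Data.List.Relation.Unary.AllPairs using (_∷_)
import Data.List.Relation.Unary.Any as Any
open import Data.List.Relation.Unary.Unique.Propositional using (Unique)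
open import Data.Nat.Base
open import Data.Nat.Combinatorics using (_C_; nC1≡n; nCk+nC[k+1]≡[n+1]C[k+1])
open import Data.Nat.Combinatorics.Specification using (k>n⇒nCk≡0)
open import Data.Nat.Properties
open import Data.Nat.Tactic.RingSolver using (solve-∀)
open import Data.Product.Base using (∃; _×_; _,_)
open import Data.Vec.Base as Vec using ([]; _∷_; lookup; here; there)
open import Data.Vec.Properties using (≡-dec)
open import Function.Base using (_∘_)
open import Relation.Binary.Definitions using (DecidableEquality)
open import Relation.Binary.PropositionalEquality
open import Relation.Nullary using (¬_; yes; no; ⌊_⌋; contradiction)
open import Relation.Nullary.Decidable using (T?; toWitness; fromWitness; isYes≗does)

open import Algebra.Properties.CommutativeMonoid.Sum +-0-commutativeMonoid
  using (sum; sum-syntax; sum-cong-≗; sum-remove; ∑-distrib-+)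
open import Algebra.Properties.Semiring.Sum +-*-semiring using (*-distribˡ-sum)

open import Defs

indicator : Bool → ℕ
indicator true  = 1
indicator false = 0

indicator≤1 : ∀ b → indicator b ≤ 1
indicator≤1 true  = ≤-refl
indicator≤1 false = z≤n

indicator-T : ∀ {b} → T b → indicator b ≡ 1
indicator-T {true} _ = refl

indicator-¬T : ∀ {b} → ¬ T b → indicator b ≡ 0
indicator-¬T {true}  ¬t = contradiction _ ¬t
indicator-¬T {false} _  = refl

indicator-∨ : ∀ a b → ¬ (T a × T b) → indicator a + indicator b ≡ indicator (a ∨ b)
indicator-∨ true  true  ¬both = contradiction (_ , _) ¬both
indicator-∨ true  false _     = refl
indicator-∨ false b     _     = refl

sum-mono-≤ : ∀ {q} {f g : Fin q → ℕ} → (∀ a → f a ≤ g a) → sum f ≤ sum g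
sum-mono-≤ {zero}  f≤g = z≤n
sum-mono-≤ {suc q} f≤g = +-mono-≤ (f≤g zero) (sum-mono-≤ (f≤g ∘ suc))

sum-zero : ∀ {q} {f : Fin q → ℕ} → (∀ a → f a ≡ 0) → sum f ≡ 0
sum-zero {zero}  f≡0 = refl
sum-zero {suc q} f≡0 = cong₂ _+_ (f≡0 zero) (sum-zero (f≡0 ∘ suc))

≤-sum : ∀ {q} (f : Fin q → ℕ) a → f a ≤ sum f
≤-sum {suc q} f a = ≤-trans (m≤m+n (f a) _) (≤-reflexive (sym (sum-remove {i = a} f)))

card : ∀ {q} → (Fin q → Bool) → ℕ
card {q} f = ∑[ a < q ] indicator (f a)

any : ∀ {q} → (Fin q → Bool) → Bool
any f = ⌊ any? (T? ∘ f) ⌋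

all : ∀ {q} → (Fin q → Bool) → Bool
all f = ⌊ all? (T? ∘ f) ⌋

card≤size : ∀ {q} (f : Fin q → Bool) → card f ≤ q
card≤size {zero}  f = z≤n
card≤size {suc q} f = +-mono-≤ (indicator≤1 (f zero)) (card≤size (f ∘ suc))

card-removeAt : ∀ {q} (f : Fin (suc q) → Bool) a → card f ≡ indicator (f a) + card (f ∘ punchIn a)
card-removeAt f a = sum-remove {i = a} (indicator ∘ f)

card≡0 : ∀ {q} (f : Fin q → Bool) → (∀ a → ¬ T (f a)) → card f ≡ 0
card≡0 f none = sum-zero (indicator-¬T ∘ none)

card-missing : ∀ {q} (f : Fin (suc q) → Bool) a → ¬ T (f a) → card f ≤ q
card-missing f a ¬fa = begin
  card f                                  ≡⟨ card-removeAt f a ⟩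
  indicator (f a) + card (f ∘ punchIn a)  ≡⟨ cong (_+ card (f ∘ punchIn a)) (indicator-¬T ¬fa) ⟩
  card (f ∘ punchIn a)                    ≤⟨ card≤size (f ∘ punchIn a) ⟩
  _                                       ∎
  where open ≤-Reasoning

card≤any+all : ∀ {q} (f : Fin (suc q) → Bool) → card f ≤ q * indicator (any f) + indicator (all f)
card≤any+all {q} f with any? (T? ∘ f) | all? (T? ∘ f)
... | yes _    | yes _ rewrite *-identityʳ q = ≤-trans (card≤size f) (≤-reflexive (+-comm 1 q))
... | no none  | yes every = contradiction (zero , every zero) none
... | no none  | no _ rewrite *-zeroʳ q = ≤-reflexive (card≡0 f (λ a fa → none (a , fa)))
... | yes _    | no ¬every rewrite *-identityʳ q | +-identityʳ q
  with a , ¬fa ← ¬∀⟶∃¬ _ _ (T? ∘ f) ¬every = card-missing f a ¬fa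

card≤any : ∀ {q} (f : Fin q → Bool) → (∀ a b → T (f a) → T (f b) → a ≡ b) → card f ≤ indicator (any f)
card≤any {zero}  f _ = z≤n
card≤any {suc q} f unique with any? (T? ∘ f)
... | no none      = ≤-reflexive (card≡0 f (λ a fa → none (a , fa)))
... | yes (a , fa) = ≤-reflexive (begin
  card f                                  ≡⟨ card-removeAt f a ⟩
  indicator (f a) + card (f ∘ punchIn a)  ≡⟨ cong₂ _+_ (indicator-T fa) (card≡0 (f ∘ punchIn a) others) ⟩
  1                                       ∎)
  where
  open ≡-Reasoning
  others : ∀ b → ¬ T (f (punchIn a b))
  others b fb = punchInᵢ≢i a b (unique _ _ fb fa)

-- The first coordinate is summed innermost, so that count (suc n) P unfolds to the sum over v of
-- card (fibre P v).
sumTuples : ∀ {q} n → (Tuple n q → ℕ) → ℕ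
sumTuples     zero    f = f []
sumTuples {q} (suc n) f = sumTuples n (λ v → ∑[ a < q ] f (a ∷ v))

sumTuples-mono-≤ : ∀ {q} n {f g : Tuple n q → ℕ} → (∀ v → f v ≤ g v) → sumTuples n f ≤ sumTuples n g
sumTuples-mono-≤ zero    f≤g = f≤g []
sumTuples-mono-≤ (suc n) f≤g = sumTuples-mono-≤ n (λ v → sum-mono-≤ (λ a → f≤g (a ∷ v)))

sumTuples-cong : ∀ {q} n {f g : Tuple n q → ℕ} → (∀ v → f v ≡ g v) → sumTuples n f ≡ sumTuples n g
sumTuples-cong zero    f≗g = f≗g []
sumTuples-cong (suc n) f≗g = sumTuples-cong n (λ v → sum-cong-≗ (λ a → f≗g (a ∷ v)))

sumTuples-zero : ∀ {q} n {f : Tuple n q → ℕ} → (∀ v → f v ≡ 0) → sumTuples n f ≡ 0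
sumTuples-zero zero    f≡0 = f≡0 []
sumTuples-zero (suc n) f≡0 = sumTuples-zero n (λ v → sum-zero (λ a → f≡0 (a ∷ v)))

sumTuples-distrib-+ : ∀ {q} n (f g : Tuple n q → ℕ) →
  sumTuples n (λ v → f v + g v) ≡ sumTuples n f + sumTuples n g
sumTuples-distrib-+ zero    f g = refl
sumTuples-distrib-+ (suc n) f g = trans
  (sumTuples-cong n (λ v → ∑-distrib-+ (λ a → f (a ∷ v)) (λ a → g (a ∷ v))))
  (sumTuples-distrib-+ n _ _)

*-distribˡ-sumTuples : ∀ {q} n k (f : Tuple n q → ℕ) → k * sumTuples n f ≡ sumTuples n (λ v → k * f v)
*-distribˡ-sumTuples zero    k f = refl
*-distribˡ-sumTuples (suc n) k f = trans
  (*-distribˡ-sumTuples n k _)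
  (sumTuples-cong n (λ v → *-distribˡ-sum k (λ a → f (a ∷ v))))

≤-sumTuples : ∀ {q} n (f : Tuple n q → ℕ) v → f v ≤ sumTuples n f
≤-sumTuples zero    f []      = ≤-refl
≤-sumTuples (suc n) f (a ∷ v) = ≤-trans (≤-sum (λ b → f (b ∷ v)) a) (≤-sumTuples n _ v)

count : ∀ {q} n → (Tuple n q → Bool) → ℕ
count n P = sumTuples n (indicator ∘ P)

count≡0 : ∀ {q} n (P : Tuple n q → Bool) → (∀ v → ¬ T (P v)) → count n P ≡ 0
count≡0 n P none = sumTuples-zero n (indicator-¬T ∘ none)

module _ {n q : ℕ} (P : Tuple (suc n) q → Bool) where

  fibre : Tuple n q → Fin q → Bool
  fibre v a = P (a ∷ v)

  proj : Tuple n q → Bool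
  proj = any ∘ fibre

  full : Tuple n q → Bool
  full = all ∘ fibre

count≤proj+full : ∀ {m} n (P : Tuple (suc n) (suc m) → Bool) →
  count (suc n) P ≤ m * count n (proj P) + count n (full P)
count≤proj+full {m} n P = begin
  count (suc n) P
    ≤⟨ sumTuples-mono-≤ n (card≤any+all ∘ fibre P) ⟩
  sumTuples n (λ v → m * indicator (proj P v) + indicator (full P v))
    ≡⟨ sumTuples-distrib-+ n _ _ ⟩
  sumTuples n (λ v → m * indicator (proj P v)) + count n (full P)
    ≡⟨ cong (_+ count n (full P)) (*-distribˡ-sumTuples n m _) ⟨
  m * count n (proj P) + count n (full P) ∎
  where open ≤-Reasoning

count≤count-proj : ∀ {q} n (P : Tuple (suc n) q → Bool) →
  (∀ v a b → T (P (a ∷ v)) → T (P (b ∷ v)) → a ≡ b) → count (suc n) P ≤ count n (proj P)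
count≤count-proj n P unique = sumTuples-mono-≤ n (λ v → card≤any (fibre P v) (unique v))

Shattersᵇ : ∀ {n q} → (Tuple n q → Bool) → Subset n → Set
Shattersᵇ {n} {q} P S = ∀ (f : Tuple n q) → ∃ λ v → T (P v) × (∀ i → i ∈ S → lookup v i ≡ lookup f i)

ShatterFree : ∀ {n q} → ℕ → (Tuple n q → Bool) → Set
ShatterFree {n} k P = ∀ (S : Subset n) → ∣ S ∣ ≡ k → ¬ Shattersᵇ P S

-- a nonempty family shatters the empty set
ShatterFree-zero⇒count≡0 : ∀ {q} n (P : Tuple n q → Bool) → ShatterFree 0 P → count n P ≡ 0
ShatterFree-zero⇒count≡0 n P free = count≡0 n P λ v Pv →
  free ⊥ (∣⊥∣≡0 n) (λ f → v , Pv , λ i i∈⊥ → contradiction i∈⊥ ∉⊥)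

proj-shatterFree : ∀ {n q k} (P : Tuple (suc n) q → Bool) → ShatterFree k P → ShatterFree k (proj P)
proj-shatterFree P free S ∣S∣≡k shatters = free (outside ∷ S) ∣S∣≡k lift
  where
  lift : Shattersᵇ P (outside ∷ S)
  lift (b ∷ f) with v , proj-v , agree ← shatters f with a , P-av ← toWitness proj-v =
    a ∷ v , P-av , λ { (suc i) (there i∈S) → agree i i∈S }

full-shatterFree : ∀ {n q k} (P : Tuple (suc n) q → Bool) → ShatterFree (suc k) P → ShatterFree k (full P)
full-shatterFree P free S ∣S∣≡k shatters = free (inside ∷ S) (cong suc ∣S∣≡k) lift
  where
  lift : Shattersᵇ P (inside ∷ S)
  lift (b ∷ f) with v , full-v , agree ← shatters f =
    b ∷ v , toWitness full-v b , λ { zero here → refl ; (suc i) (there i∈S) → agree i i∈S }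

-- The q-ary Sauer–Shelah bound

sauerBound : ℕ → ℕ → ℕ → ℕ
sauerBound m n zero    = 0
sauerBound m n (suc s) = sauerBound m n s + m ^ (n ∸ s) * (n C s)

1≤sauerBound : ∀ m s → 1 ≤ sauerBound m 0 (suc s)
1≤sauerBound m zero    = ≤-refl
1≤sauerBound m (suc s) = ≤-trans (1≤sauerBound m s) (m≤m+n _ _)

sauerBound-suc : ∀ m n s → sauerBound m (suc n) (suc s) ≡ m * sauerBound m n (suc s) + sauerBound m n s
sauerBound-suc m n zero    = trans (*-assoc m (m ^ n) 1) (sym (+-identityʳ _))
sauerBound-suc m n (suc s) = begin
  sauerBound m (suc n) (suc s) + p * (suc n C suc s)
    ≡⟨ cong₂ (λ x y → x + p * y) (sauerBound-suc m n s) (sym (nCk+nC[k+1]≡[n+1]C[k+1] n s)) ⟩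
  (m * S₁ + S₀) + p * (n C s + n C suc s)
    ≡⟨ cong (_+_ (m * S₁ + S₀)) (trans (*-distribˡ-+ p (n C s) _) (+-comm (p * (n C s)) _)) ⟩
  (m * S₁ + S₀) + (p * (n C suc s) + p * (n C s))
    ≡⟨ interchange +-commutativeSemigroup (m * S₁) S₀ _ _ ⟩
  (m * S₁ + p * (n C suc s)) + (S₀ + p * (n C s))
    ≡⟨ cong (λ x → m * S₁ + x + (S₀ + p * (n C s))) shift ⟨
  (m * S₁ + m * (m ^ (n ∸ suc s) * (n C suc s))) + (S₀ + p * (n C s))
    ≡⟨ cong (_+ (S₀ + p * (n C s))) (*-distribˡ-+ m S₁ _) ⟨
  m * (S₁ + m ^ (n ∸ suc s) * (n C suc s)) + (S₀ + p * (n C s)) ∎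
  where
  open ≡-Reasoning
  S₁ = sauerBound m n (suc s)
  S₀ = sauerBound m n s
  p = m ^ (n ∸ s)
  -- for s ≥ n both sides vanish, since then C(n, s + 1) = 0
  shift : m * (m ^ (n ∸ suc s) * (n C suc s)) ≡ p * (n C suc s)
  shift with s <? n
  ... | yes s<n = trans (sym (*-assoc m _ _)) (cong (λ e → m ^ e * (n C suc s)) (sym (+-∸-assoc 1 s<n)))
  ... | no s≮n rewrite k>n⇒nCk≡0 (s≤s (≮⇒≥ s≮n)) =
    trans (cong (m *_) (*-zeroʳ (m ^ (n ∸ suc s)))) (trans (*-zeroʳ m) (sym (*-zeroʳ p)))

count≤sauerBound : ∀ {m} n s (P : Tuple n (suc m) → Bool) → ShatterFree s P → count n P ≤ sauerBound m n s
count≤sauerBound n       zero    P free = ≤-reflexive (ShatterFree-zero⇒count≡0 n P free)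
count≤sauerBound zero    (suc s) P free = ≤-trans (indicator≤1 (P [])) (1≤sauerBound _ s)
count≤sauerBound {m} (suc n) (suc s) P free = begin
  count (suc n) P                               ≤⟨ count≤proj+full n P ⟩
  m * count n (proj P) + count n (full P)       ≤⟨ +-mono-≤ (*-monoʳ-≤ m proj-bound) full-bound ⟩
  m * sauerBound m n (suc s) + sauerBound m n s ≡⟨ sauerBound-suc m n s ⟨
  sauerBound m (suc n) (suc s)                  ∎
  where
  open ≤-Reasoning
  proj-bound : count n (proj P) ≤ sauerBound m n (suc s)
  proj-bound = count≤sauerBound n (suc s) (proj P) (proj-shatterFree P free)
  full-bound : count n (full P) ≤ sauerBound m n s
  full-bound = count≤sauerBound n s (full P) (full-shatterFree P free)

-- Binary families with weights in a window

weight : ∀ {n q} → Tuple n q → ℕ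
weight v = Vec.sum (Vec.map toℕ v)

InWindow : ∀ {n q} → ℕ → ℕ → (Tuple n q → Bool) → Set
InWindow lo k P = ∀ v → T (P v) → lo ≤ weight v × weight v < lo + k

proj-inWindow : ∀ {n lo k} (P : Tuple (suc n) 2 → Bool) → InWindow lo k P → InWindow (lo ∸ 1) (suc k) (proj P)
proj-inWindow {lo = lo} {k} P window v proj-v
  with a , P-av ← toWitness proj-v with lo≤ , <lo+k ← window (a ∷ v) P-av = lower , upper
  where
  lower : lo ∸ 1 ≤ weight v
  lower = ≤-trans (∸-mono lo≤ (toℕ≤pred[n] a)) (≤-reflexive (m+n∸m≡n (toℕ a) (weight v)))
  upper : weight v < lo ∸ 1 + suc k
  upper = begin-strict
    weight v          ≤⟨ m≤n+m (weight v) (toℕ a) ⟩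
    toℕ a + weight v  <⟨ <lo+k ⟩
    lo + k            ≤⟨ +-monoˡ-≤ k (m≤n+m∸n lo 1) ⟩
    suc (lo ∸ 1 + k)  ≡⟨ +-suc (lo ∸ 1) k ⟨
    lo ∸ 1 + suc k    ∎
    where open ≤-Reasoning

full-inWindow : ∀ {n lo k} (P : Tuple (suc n) 2 → Bool) → InWindow lo (suc k) P → InWindow lo k (full P)
full-inWindow {lo = lo} {k} P window v full-v
  with lo≤ , _ ← window (zero ∷ v) (toWitness full-v zero)
  with _ , <lo+k ← window (suc zero ∷ v) (toWitness full-v (suc zero)) =
    lo≤ , ≤-pred (≤-trans <lo+k (≤-reflexive (+-suc lo k)))

windowBound : ℕ → ℕ → ℕ → ℕ
windowBound n s       zero    = 0
windowBound n zero    (suc k) = 1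
windowBound n (suc s) (suc k) = n C suc s + windowBound n s k

windowBound-one : ∀ n s → windowBound n s 1 ≡ n C s
windowBound-one n zero    = refl
windowBound-one n (suc s) = +-identityʳ _

1≤windowBound : ∀ n s k → s ≤ k → 1 ≤ windowBound n s (suc k)
1≤windowBound n zero    k       _         = ≤-refl
1≤windowBound n (suc s) (suc k) (s≤s s≤k) = ≤-trans (1≤windowBound n s k s≤k) (m≤n+m _ _)

windowBound-pascal : ∀ n s k → windowBound (suc n) (suc s) k ≡ windowBound n (suc s) k + windowBound n s k
windowBound-pascal n s       zero          = refl
windowBound-pascal n zero    (suc zero)    rewrite nC1≡n (suc n) | nC1≡n n = +-comm 1 (n + 0)
windowBound-pascal n zero    (suc (suc k)) rewrite nC1≡n (suc n) | nC1≡n n = +-comm 1 (n + 1)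
windowBound-pascal n (suc s) (suc k) = begin
  suc n C suc (suc s) + windowBound (suc n) (suc s) k
    ≡⟨ cong₂ _+_ (sym (nCk+nC[k+1]≡[n+1]C[k+1] n (suc s))) (windowBound-pascal n s k) ⟩
  (n C suc s + n C suc (suc s)) + (windowBound n (suc s) k + windowBound n s k)
    ≡⟨ cong (_+ (windowBound n (suc s) k + windowBound n s k)) (+-comm (n C suc s) _) ⟩
  (n C suc (suc s) + n C suc s) + (windowBound n (suc s) k + windowBound n s k)
    ≡⟨ interchange +-commutativeSemigroup (n C suc (suc s)) _ _ _ ⟩
  (n C suc (suc s) + windowBound n (suc s) k) + (n C suc s + windowBound n s k) ∎
  where open ≡-Reasoning

count≤windowBound : ∀ n s k lo (P : Tuple n 2 → Bool) → 2 * s < n + k → InWindow lo k P →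
  ShatterFree (suc s) P → count n P ≤ windowBound n s k
count≤windowBound n s zero lo P _ window _ = ≤-reflexive (count≡0 n P empty)
  where
  empty : ∀ v → ¬ T (P v)
  empty v Pv with lo≤ , <lo+0 ← window v Pv = <⇒≱ (subst (_ <_) (+-identityʳ lo) <lo+0) lo≤
count≤windowBound zero s (suc k) lo P 2s<k _ _ =
  ≤-trans (indicator≤1 (P [])) (1≤windowBound 0 s k (≤-trans (m≤m+n s (s + 0)) (≤-pred 2s<k)))
count≤windowBound (suc n) zero (suc k) lo P 0<n+k window free = begin
  count (suc n) P                          ≤⟨ count≤proj+full n P ⟩
  1 * count n (proj P) + count n (full P)  ≡⟨ cong₂ _+_ (*-identityˡ _) full-empty ⟩
  count n (proj P) + 0                     ≤⟨ +-monoˡ-≤ 0 proj-bound ⟩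
  windowBound (suc n) 0 (suc k)            ∎
  where
  open ≤-Reasoning
  full-empty : count n (full P) ≡ 0
  full-empty = ShatterFree-zero⇒count≡0 n (full P) (full-shatterFree P free)
  proj-bound : count n (proj P) ≤ windowBound n 0 (2 + k)
  proj-bound = count≤windowBound n 0 (2 + k) (lo ∸ 1) (proj P)
    (subst (0 <_) (sym (+-suc n (suc k))) 0<n+k) (proj-inWindow P window) (proj-shatterFree P free)
count≤windowBound (suc n) (suc s) (suc k) lo P 2s<n+k window free = begin
  count (suc n) P                                           ≤⟨ count≤proj+full n P ⟩
  1 * count n (proj P) + count n (full P)                   ≡⟨ cong (_+ count n (full P)) (*-identityˡ _) ⟩
  count n (proj P) + count n (full P)                       ≤⟨ +-mono-≤ proj-bound full-bound ⟩
  (n C suc s + windowBound n s (suc k)) + windowBound n s k ≡⟨ xy∙z≈xz∙y +-commutativeSemigroup (n C suc s) _ _ ⟩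
  (n C suc s + windowBound n s k) + windowBound n s (suc k) ≡⟨ windowBound-pascal n s (suc k) ⟨
  windowBound (suc n) (suc s) (suc k)                       ∎
  where
  open ≤-Reasoning
  proj-invariant : 2 * suc s < n + suc (suc k)
  proj-invariant = subst (2 * suc s <_) (sym (+-suc n (suc k))) 2s<n+k
  full-invariant : 2 * s < n + k
  full-invariant = ≤-pred (begin
    2 + 2 * s    ≡⟨ *-suc 2 s ⟨
    2 * suc s    ≤⟨ ≤-pred 2s<n+k ⟩
    n + suc k    ≡⟨ +-suc n k ⟩
    suc (n + k)  ∎)
  proj-bound : count n (proj P) ≤ windowBound n (suc s) (2 + k)
  proj-bound = count≤windowBound n (suc s) (2 + k) (lo ∸ 1) (proj P)
    proj-invariant (proj-inWindow P window) (proj-shatterFree P free)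
  full-bound : count n (full P) ≤ windowBound n s k
  full-bound = count≤windowBound n s k lo (full P)
    full-invariant (full-inWindow P window) (full-shatterFree P free)

uniform⇒fibre-unique : ∀ {n q d} (P : Tuple (suc n) q → Bool) → (∀ v → T (P v) → weight v ≡ d) →
  ∀ v a b → T (P (a ∷ v)) → T (P (b ∷ v)) → a ≡ b
uniform⇒fibre-unique P uniform v a b Pav Pbv =
  toℕ-injective (+-cancelʳ-≡ (weight v) (toℕ a) (toℕ b) (trans (uniform _ Pav) (sym (uniform _ Pbv))))

binary-count≤C : ∀ n s d (P : Tuple n 2 → Bool) → 2 * s ≤ n → (∀ v → T (P v) → weight v ≡ d) →
  ShatterFree (suc s) P → count n P ≤ n C s
binary-count≤C n s d P 2s≤n uniform free = begin
  count n P           ≤⟨ count≤windowBound n s 1 d P (subst (2 * s <_) (+-comm 1 n) (s≤s 2s≤n)) window free ⟩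
  windowBound n s 1   ≡⟨ windowBound-one n s ⟩
  n C s               ∎
  where
  open ≤-Reasoning
  window : InWindow d 1 P
  window v Pv = ≤-reflexive (sym (uniform v Pv)) , ≤-reflexive (trans (cong suc (uniform v Pv)) (+-comm 1 d))

count≤sauerBound-uniform : ∀ {r} m s d (P : Tuple (suc m) (2 + r) → Bool) → (∀ v → T (P v) → weight v ≡ d) →
  ShatterFree s P → count (suc m) P ≤ sauerBound (suc r) m s
count≤sauerBound-uniform m s d P uniform free = ≤-trans
  (count≤count-proj m P (uniform⇒fibre-unique P uniform))
  (count≤sauerBound m s (proj P) (proj-shatterFree P free))

_≟ᵗ_ : ∀ {n q} → DecidableEquality (Tuple n q)
_≟ᵗ_ = ≡-dec _≟ᶠ_

member : ∀ {n q} → List (Tuple n q) → Tuple n q → Bool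
member V v = ⌊ Any.any? (v ≟ᵗ_) V ⌋

member-∷ : ∀ {n q} x (V : List (Tuple n q)) v → member (x ∷ V) v ≡ ⌊ v ≟ᵗ x ⌋ ∨ member V v
member-∷ x V v = trans (isYes≗does (Any.any? (v ≟ᵗ_) (x ∷ V)))
  (sym (cong₂ _∨_ (isYes≗does (v ≟ᵗ x)) (isYes≗does (Any.any? (v ≟ᵗ_) V))))

length≤count-member : ∀ {n q} (V : List (Tuple n q)) → Unique V → length V ≤ count n (member V)
length≤count-member     []      _              = z≤n
length≤count-member {n} (x ∷ V) (x∉V ∷ unique) = begin
  1 + length V
    ≤⟨ +-mono-≤ x-counted (length≤count-member V unique) ⟩
  count n (λ v → ⌊ v ≟ᵗ x ⌋) + count n (member V)
    ≡⟨ sumTuples-distrib-+ n _ _ ⟨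
  sumTuples n (λ v → indicator ⌊ v ≟ᵗ x ⌋ + indicator (member V v))
    ≡⟨ sumTuples-cong n disjoint ⟩
  count n (member (x ∷ V)) ∎
  where
  open ≤-Reasoning
  x-counted : 1 ≤ count n (λ v → ⌊ v ≟ᵗ x ⌋)
  x-counted = ≤-trans (≤-reflexive (sym (indicator-T (fromWitness refl)))) (≤-sumTuples n _ x)
  disjoint : ∀ v → indicator ⌊ v ≟ᵗ x ⌋ + indicator (member V v) ≡ indicator (member (x ∷ V) v)
  disjoint v = trans
    (indicator-∨ ⌊ v ≟ᵗ x ⌋ (member V v) λ (v≡x , v∈V) →
      All¬⇒¬Any x∉V (subst (_∈ˡ V) (toWitness v≡x) (toWitness v∈V)))
    (cong indicator (sym (member-∷ x V v)))

member-uniform : ∀ {n q d} (V : List (Tuple n q)) → Uniform d V → ∀ v → T (member V v) → weight v ≡ d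
member-uniform V uniform v v∈V = uniform v (toWitness v∈V)

member-shatterFree : ∀ {n q k} (V : List (Tuple n q)) →
  (∀ S → ∣ S ∣ ≡ k → ¬ Shatters V S) → ShatterFree k (member V)
member-shatterFree V noShatter S ∣S∣≡k shatters = noShatter S ∣S∣≡k λ f →
  let v , v∈V , agree = shatters f in v , toWitness v∈V , agree

m+n≡p+o⇒+m+[+n-+o]≡+p : ∀ m n p o → m + n ≡ p + o → + m ℤ.+ (+ n ℤ.- + o) ≡ + p
m+n≡p+o⇒+m+[+n-+o]≡+p m n p o eq = begin
  + m ℤ.+ (+ n ℤ.- + o)  ≡⟨ ℤ.+-assoc (+ m) (+ n) (ℤ.- + o) ⟨
  + m ℤ.+ + n ℤ.- + o    ≡⟨ cong (ℤ._- + o) (ℤ.pos-+ m n) ⟨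
  + (m + n) ℤ.- + o      ≡⟨ ℤ.m-n≡m⊖n (m + n) o ⟩
  (m + n) ⊖ o            ≡⟨ cong (_⊖ o) eq ⟩
  (p + o) ⊖ o            ≡⟨ ℤ.≤-⊖ (m≤n+m o p) ⟩
  + (p + o ∸ o)          ≡⟨ cong +_ (m+n∸n≡m p o) ⟩
  + p                    ∎
  where open ≡-Reasoning

pos-*-distribˡ-minus : ∀ p a b → + p ℤ.* (+ a ℤ.- + b) ≡ + (p * a) ℤ.- + (p * b)
pos-*-distribˡ-minus p a b = begin
  + p ℤ.* (+ a ℤ.- + b)
    ≡⟨ ℤ.*-distribˡ-+ (+ p) (+ a) (ℤ.- + b) ⟩
  + p ℤ.* + a ℤ.+ + p ℤ.* (ℤ.- + b)
    ≡⟨ cong₂ ℤ._+_ (ℤ.pos-* p a) (trans (cong ℤ.-_ (ℤ.pos-* p b)) (ℤ.neg-distribʳ-* (+ p) (+ b))) ⟨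
  + (p * a) ℤ.- + (p * b) ∎
  where open ≡-Reasoning

bound-binary : ∀ n s → bound n 2 s ≡ + (n C s)
bound-binary n zero    = cong (λ x → + x ℤ.* + 1) (^-zeroˡ n)
bound-binary n (suc s) = begin
  bound n 2 s ℤ.+ + (1 ^ (n ∸ suc s)) ℤ.* (+ (n C suc s) ℤ.- + (n C s))
    ≡⟨ cong₂ (λ b p → b ℤ.+ + p ℤ.* (+ (n C suc s) ℤ.- + (n C s))) (bound-binary n s) (^-zeroˡ (n ∸ suc s)) ⟩
  + (n C s) ℤ.+ + 1 ℤ.* (+ (n C suc s) ℤ.- + (n C s))
    ≡⟨ cong (ℤ._+_ (+ (n C s))) (ℤ.*-identityˡ (+ (n C suc s) ℤ.- + (n C s))) ⟩
  + (n C s) ℤ.+ (+ (n C suc s) ℤ.- + (n C s))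
    ≡⟨ m+n≡p+o⇒+m+[+n-+o]≡+p (n C s) (n C suc s) (n C suc s) (n C s) (+-comm (n C s) (n C suc s)) ⟩
  + (n C suc s) ∎
  where open ≡-Reasoning

C-suc : ∀ m s → suc m C s ≡ m C s + prevBinom m s
C-suc m zero    = refl
C-suc m (suc s) = trans (sym (nCk+nC[k+1]≡[n+1]C[k+1] m s)) (+-comm (m C s) _)

step-identity : ∀ r S p Cm δ c₁ →
  S + (2 + r) * p * (Cm + δ) + p * c₁ ≡ (S + p * Cm + p * c₁ + (r * p * (Cm + δ) + p * δ)) + p * (Cm + δ)
step-identity = solve-∀

-- The summand R^(m+1-s)·C(m+1, s) makes the induction go through: in the step it absorbs the
-- negative part of the next term of bound, leaving the surplus
-- (R - 2)·R^(m-s)·C(m+1, s) + R^(m-s)·C(m, s-1) ≥ 0 (this is where q ≥ 3 is used).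
bound-lower : ∀ r m s → s ≤ m →
  + (sauerBound (2 + r) m s + (2 + r) ^ (suc m ∸ s) * (suc m C s)) ≤ℤ bound (suc m) (3 + r) s
bound-lower r m zero    _   = ℤ.≤-reflexive (ℤ.pos-* ((2 + r) ^ suc m) 1)
bound-lower r m (suc s) s<m = begin
  + (S + p * (m C s) + p * (suc m C suc s))
    ≤⟨ step S p (m C s) (prevBinom m s) (suc m C suc s) ⟩
  + (S + R * p * (m C s + prevBinom m s)) ℤ.+ + p ℤ.* (+ (suc m C suc s) ℤ.- + (m C s + prevBinom m s))
    ≡⟨ cong₂ (λ e c → + (S + e * c) ℤ.+ + p ℤ.* (+ (suc m C suc s) ℤ.- + c)) R*p≡R^[1+m-s] (sym (C-suc m s)) ⟩
  + (S + R ^ (suc m ∸ s) * (suc m C s)) ℤ.+ term (suc m) (3 + r) (suc s)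
    ≤⟨ ℤ.+-monoˡ-≤ _ (bound-lower r m s (<⇒≤ s<m)) ⟩
  bound (suc m) (3 + r) (suc s) ∎
  where
  open ℤ.≤-Reasoning
  R = 2 + r
  S = sauerBound R m s
  p = R ^ (m ∸ s)
  R*p≡R^[1+m-s] : R * p ≡ R ^ (suc m ∸ s)
  R*p≡R^[1+m-s] = cong (R ^_) (sym (+-∸-assoc 1 (<⇒≤ s<m)))
  step : ∀ S p Cm δ c₁ →
    + (S + p * Cm + p * c₁) ≤ℤ + (S + (2 + r) * p * (Cm + δ)) ℤ.+ + p ℤ.* (+ c₁ ℤ.- + (Cm + δ))
  step S p Cm δ c₁ = begin
    + (S + p * Cm + p * c₁)
      ≤⟨ +≤+ (m≤m+n _ (r * p * (Cm + δ) + p * δ)) ⟩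
    + (S + p * Cm + p * c₁ + (r * p * (Cm + δ) + p * δ))
      ≡⟨ m+n≡p+o⇒+m+[+n-+o]≡+p _ (p * c₁) _ (p * (Cm + δ)) (step-identity r S p Cm δ c₁) ⟨
    + (S + (2 + r) * p * (Cm + δ)) ℤ.+ (+ (p * c₁) ℤ.- + (p * (Cm + δ)))
      ≡⟨ cong (ℤ._+_ (+ (S + (2 + r) * p * (Cm + δ)))) (pos-*-distribˡ-minus p c₁ (Cm + δ)) ⟨
    + (S + (2 + r) * p * (Cm + δ)) ℤ.+ + p ℤ.* (+ c₁ ℤ.- + (Cm + δ)) ∎

2*s≤1+m⇒s≤m : ∀ s m → 2 * s ≤ suc m → s ≤ m
2*s≤1+m⇒s≤m zero    m _       = z≤n
2*s≤1+m⇒s≤m (suc s) m 2s≤1+m = begin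
  suc s              ≤⟨ s≤s (m≤m+n s (s + 0)) ⟩
  suc (s + (s + 0))  ≡⟨ +-suc s (s + 0) ⟨
  s + suc (s + 0)    ≤⟨ ≤-pred 2s≤1+m ⟩
  m                  ∎
  where open ≤-Reasoning

sauerBound≤bound : ∀ r m s → 2 * s ≤ suc m → + sauerBound (2 + r) m (suc s) ≤ℤ bound (suc m) (3 + r) s
sauerBound≤bound r m s 2s≤1+m = ℤ.≤-trans (+≤+ (+-monoʳ-≤ S (*-mono-≤ power binomial))) (bound-lower r m s s≤m)
  where
  R = 2 + r
  S = sauerBound R m s
  s≤m : s ≤ m
  s≤m = 2*s≤1+m⇒s≤m s m 2s≤1+m
  power : R ^ (m ∸ s) ≤ R ^ (suc m ∸ s)
  power = ^-monoʳ-≤ R (∸-monoˡ-≤ s (n≤1+n m))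
  binomial : m C s ≤ suc m C s
  binomial = ≤-trans (m≤m+n (m C s) (prevBinom m s)) (≤-reflexive (sym (C-suc m s)))

theorem4 : (n q d s : ℕ) → 1 ≤ n → 2 ≤ q → d ≤ n * (q ∸ 1) → 2 * s ≤ n →
    (V : List (Tuple n q)) → Unique V → Uniform d V →
    (∀ (S : Subset n) → ∣ S ∣ ≡ suc s → ¬ Shatters V S) →
    + length V ≤ℤ bound n q s
theorem4 n 0 d s _ () _ _ V _ _ _
theorem4 n 1 d s _ (s≤s ()) _ _ V _ _ _
theorem4 n 2 d s _ _ _ 2s≤n V unique uniform noShatter = begin
  + length V            ≤⟨ +≤+ (length≤count-member V unique) ⟩
  + count n (member V)  ≤⟨ +≤+ (binary-count≤C n s d (member V) 2s≤n
                                  (member-uniform V uniform) (member-shatterFree V noShatter)) ⟩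
  + (n C s)             ≡⟨ bound-binary n s ⟨
  bound n 2 s           ∎
  where open ℤ.≤-Reasoning
theorem4 zero (suc (suc (suc r))) d s () _ _ _ V _ _ _
theorem4 (suc m) (suc (suc (suc r))) d s _ _ _ 2s≤n V unique uniform noShatter = begin
  + length V                       ≤⟨ +≤+ (length≤count-member V unique) ⟩
  + count (suc m) (member V)       ≤⟨ +≤+ (count≤sauerBound-uniform m (suc s) d (member V)
                                             (member-uniform V uniform) (member-shatterFree V noShatter)) ⟩
  + sauerBound (2 + r) m (suc s)   ≤⟨ sauerBound≤bound r m s 2s≤n ⟩
  bound (suc m) (3 + r) s          ∎
  where open ℤ.≤-Reasoning
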